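{- Let $T^{\natural}=(S^{\natural},I^{\natural},R^{\natural},V^{\natural})$ be an infinite-state transition system with $V^{\natural}=V^{\natural}_{bool}\cup V^{\natural}_{int}$, let $\varphi=\{\varphi_1,\dots,\varphi_n\}$ be a set of predicates with $V(\varphi)\subseteq V^{\natural}_{int}$, and let $T^{\sharp}=(S^{\sharp},I^{\sharp},R^{\sharp},V^{\sharp})$ be the partially predicate abstracted transition system: $V^{\sharp}=(V^{\natural}\cup\{b_1,\dots,b_n\})\setminus V(\varphi)$, $S^{\sharp}=\bigcup_{s\in S^{\natural}}\alpha(s)$, $I^{\sharp}=\bigcup_{s\in I^{\natural}}\alpha(s)$, $R^{\sharp}=\bigcup_{r\in R^{\natural}}\alpha^{\tau}(r)$. Then for every ACTL formula $f^{\sharp}$ over the variables $V^{\sharp}$, if $T^{\sharp}\models f^{\sharp}$ then $T^{\natural}\models\gamma(f^{\sharp})$.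
   Context: A transition system $T=(S,I,R,V)$ has $S\subseteq\mathcal{B}^{|V_{bool}|}\times\mathcal{Z}^{|V_{int}|}$, $I\subseteq S$, $R\subseteq S\times S$; $T\models f$ means every initial state satisfies the CTL formula $f$. ACTL is the universal fragment of CTL. $b_1,\dots,b_n$ are fresh boolean variables; $\varphi_i'$ is $\varphi_i$ with variables primed. $\alpha(s)=\exists V(\varphi).(s\wedge\bigwedge_i(\varphi_i\iff b_i))$; $\alpha^{\tau}(r)=\exists V(\varphi).\exists V(\varphi').(r\wedge CS\wedge\bigwedge_i(\varphi_i\iff b_i)\wedge\bigwedge_i(\varphi_i'\iff b_i'))$ with $CS=\bigwedge_i((\bigwedge_{v\in V(\varphi_i)}v'=v)\implies(b_i'\iff b_i))$. For a state formula $s^{\sharp}$, $\gamma(s^{\sharp})=s^{\sharp}[\bar\varphi/\bar b]$ (replace each $b_i$ by $\varphi_i$); for a temporal formula $f^{\sharp}$, $\gamma(f^{\sharp})$ denotes the formula obtained by recursively replacing every atomic subformula $a$ of $f^{\sharp}$ by $\gamma(a)$ (e.g. if $b_1,b_2$ stand for $z=1,z<1$ then $\gamma(AG(b_1\vee b_2))=AG(z=1\vee z<1)$). -}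

module Defs where

open import Data.Nat using (ℕ; _<_)
open import Data.Fin using (Fin)
open import Data.Bool using (Bool)
open import Data.Integer using (ℤ)
open import Data.List using (List)
open import Data.List.Membership.Propositional using (_∈_)
open import Data.Product using (_×_; _,_; ∃-syntax; Σ-syntax)
open import Data.Sum using (_⊎_)
open import Relation.Nullary using (¬_)
open import Relation.Binary.PropositionalEquality using (_≡_)

-- Transition systems T = (S, I, R) over a state type (valuations of V)

record TS (St : Set) : Set₁ where
  field
    S : St → Set
    I : St → Set
    R : St → St → Set

WellFormed : {St : Set} → TS St → Set
WellFormed T = (∀ s → I s → S s) × (∀ s t → R s t → S s × S t)
  where open TS T

-- ACTL formulas (negation normal form; atoms are state formulas,
-- i.e. predicates on valuations, so negated atoms are atoms as well)

infixr 6 _∧_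
infixr 5 _∨_

data ACTL (St : Set) : Set₁ where
  atom : (St → Set) → ACTL St
  _∧_  : ACTL St → ACTL St → ACTL St
  _∨_  : ACTL St → ACTL St → ACTL St
  AX   : ACTL St → ACTL St
  AF   : ACTL St → ACTL St
  AG   : ACTL St → ACTL St
  AU   : ACTL St → ACTL St → ACTL St
  AR   : ACTL St → ACTL St → ACTL St

mapAtoms : {St St' : Set} → ((St → Set) → (St' → Set)) → ACTL St → ACTL St'
mapAtoms g (atom p) = atom (g p)
mapAtoms g (f ∧ h)  = mapAtoms g f ∧ mapAtoms g h
mapAtoms g (f ∨ h)  = mapAtoms g f ∨ mapAtoms g h
mapAtoms g (AX f)   = AX (mapAtoms g f)
mapAtoms g (AF f)   = AF (mapAtoms g f)
mapAtoms g (AG f)   = AG (mapAtoms g f)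
mapAtoms g (AU f h) = AU (mapAtoms g f) (mapAtoms g h)
mapAtoms g (AR f h) = AR (mapAtoms g f) (mapAtoms g h)

module Semantics {St : Set} (T : TS St) where
  open TS T

  IsPathFrom : St → (ℕ → St) → Set
  IsPathFrom s π = (π 0 ≡ s) × (∀ k → R (π k) (π (ℕ.suc k)))

  sat : St → ACTL St → Set
  sat s (atom p) = p s
  sat s (f ∧ g)  = sat s f × sat s g
  sat s (f ∨ g)  = sat s f ⊎ sat s g
  sat s (AX f)   = ∀ π → IsPathFrom s π → sat (π 1) f
  sat s (AF f)   = ∀ π → IsPathFrom s π → ∃[ k ] sat (π k) f
  sat s (AG f)   = ∀ π → IsPathFrom s π → ∀ k → sat (π k) f
  sat s (AU f g) = ∀ π → IsPathFrom s π →
                   ∃[ k ] (sat (π k) g × (∀ j → j < k → sat (π j) f))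
  sat s (AR f g) = ∀ π → IsPathFrom s π →
                   ∀ k → sat (π k) g ⊎ (∃[ j ] (j < k × sat (π j) f))

_⊨_ : {St : Set} → TS St → ACTL St → Set
T ⊨ f = ∀ s → TS.I T s → Semantics.sat T s f

-- Concrete states: valuations of V_bool = Fin nb and V_int = Fin ni

record CState (nb ni : ℕ) : Set where
  constructor cstate
  field
    bv : Fin nb → Bool
    iv : Fin ni → ℤ

record Predicate (ni : ℕ) : Set where
  field
    vars  : List (Fin ni)
    eval  : (Fin ni → ℤ) → Bool
    local : ∀ σ τ → (∀ v → v ∈ vars → σ v ≡ τ v) → eval σ ≡ eval τ

open Predicate public

module Abstraction {nb ni n : ℕ} (φ : Fin n → Predicate ni) where

  InVφ : Fin ni → Set
  InVφ v = ∃[ i ] (v ∈ vars (φ i))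

  -- Abstract states: valuations of
  -- V♯ = V_bool ∪ {b₁,…,bₙ} ∪ (V_int ∖ V(φ))
  record AState : Set where
    field
      bv : Fin nb → Bool
      bp : Fin n → Bool
      iv : (v : Fin ni) → ¬ InVφ v → ℤ

  Abs : CState nb ni → AState → Set
  Abs σ σ♯ = (∀ x → AState.bv σ♯ x ≡ CState.bv σ x)
           × (∀ v (p : ¬ InVφ v) → AState.iv σ♯ v p ≡ CState.iv σ v)
           × (∀ i → AState.bp σ♯ i ≡ eval (φ i) (CState.iv σ))

  -- α(s) = ∃V(φ). (s ∧ ⋀ᵢ (φᵢ ⇔ bᵢ))
  α : (CState nb ni → Set) → AState → Set
  α s σ♯ = ∃[ σ ] (s σ × Abs σ σ♯)

  CS : CState nb ni → CState nb ni → AState → AState → Set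
  CS σ σ' σ♯ σ♯' = ∀ i → (∀ v → v ∈ vars (φ i) → CState.iv σ' v ≡ CState.iv σ v)
                       → AState.bp σ♯' i ≡ AState.bp σ♯ i

  -- ατ(r) = ∃V(φ).∃V(φ'). (r ∧ CS ∧ ⋀ᵢ(φᵢ ⇔ bᵢ) ∧ ⋀ᵢ(φᵢ' ⇔ bᵢ'))
  ατ : (CState nb ni → CState nb ni → Set) → AState → AState → Set
  ατ r σ♯ σ♯' = ∃[ σ ] ∃[ σ' ] (r σ σ' × CS σ σ' σ♯ σ♯' × Abs σ σ♯ × Abs σ' σ♯')

  -- the state formula characterising a single concrete state s
  Single : CState nb ni → CState nb ni → Set
  Single s t = (∀ x → CState.bv t x ≡ CState.bv s x) × (∀ v → CState.iv t v ≡ CState.iv s v)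

  SingleT : CState nb ni → CState nb ni → CState nb ni → CState nb ni → Set
  SingleT s s' t t' = Single s t × Single s' t'

  abstractTS : TS (CState nb ni) → TS AState
  abstractTS T = record
    { S = λ σ♯ → ∃[ s ] (TS.S T s × α (Single s) σ♯)
    ; I = λ σ♯ → ∃[ s ] (TS.I T s × α (Single s) σ♯)
    ; R = λ σ♯ σ♯' → ∃[ s ] ∃[ s' ] (TS.R T s s' × ατ (SingleT s s') σ♯ σ♯')
    }

  -- γ(a) = a[φ̄/b̄] : evaluate a with bᵢ := φᵢ, other variables unchanged
  γa : (AState → Set) → (CState nb ni → Set)
  γa a σ = a (record { bv = CState.bv σ
                     ; bp = λ i → eval (φ i) (CState.iv σ)
                     ; iv = λ v _ → CState.iv σ v })

  γ : ACTL AState → ACTL (CState nb ni)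
  γ = mapAtoms γa

-- Sending a concrete state σ to the abstract state with bᵢ := φᵢ(σ) maps every
-- concrete transition to an abstract one (CS holds because each φᵢ depends only
-- on V(φᵢ)), hence every concrete path to an abstract path.  Universal path
-- formulas are therefore reflected along this map, and γ is exactly
-- precomposition of the atoms with it.
module Submission where

open import Defs
open import Data.Nat using (ℕ)
open import Data.Fin using (Fin)
open import Data.Product using (_,_)
open import Data.Sum using (inj₁; inj₂)
open import Relation.Binary.PropositionalEquality using (refl; cong)

module _ {St St′ : Set} {T : TS St} {T′ : TS St′} (h : St → St′)
         (h-preserves-R : ∀ {s s′} → TS.R T s s′ → TS.R T′ (h s) (h s′)) where
  private
    module C = Semantics T
    module A = Semantics T′

  map-path : ∀ {s π} → C.IsPathFrom s π → A.IsPathFrom (h s) (λ k → h (π k))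
  map-path (π₀≡s , steps) = cong h π₀≡s , λ k → h-preserves-R (steps k)

  sat-reflect : ∀ f {s} → A.sat (h s) f → C.sat s (mapAtoms (λ p σ → p (h σ)) f)
  sat-reflect (atom p) x = x
  sat-reflect (f ∧ g) (x , y) = sat-reflect f x , sat-reflect g y
  sat-reflect (f ∨ g) (inj₁ x) = inj₁ (sat-reflect f x)
  sat-reflect (f ∨ g) (inj₂ y) = inj₂ (sat-reflect g y)
  sat-reflect (AX f) x π path = sat-reflect f (x _ (map-path path))
  sat-reflect (AF f) x π path with x _ (map-path path)
  ... | k , y = k , sat-reflect f y
  sat-reflect (AG f) x π path k = sat-reflect f (x _ (map-path path) k)
  sat-reflect (AU f g) x π path with x _ (map-path path)
  ... | k , y , before = k , sat-reflect g y , λ j j<k → sat-reflect f (before j j<k)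
  sat-reflect (AR f g) x π path k with x _ (map-path path) k
  ... | inj₁ y = inj₁ (sat-reflect g y)
  ... | inj₂ (j , j<k , y) = inj₂ (j , j<k , sat-reflect f y)

  ⊨-reflect : (∀ {s} → TS.I T s → TS.I T′ (h s)) →
              ∀ f → T′ ⊨ f → T ⊨ mapAtoms (λ p σ → p (h σ)) f
  ⊨-reflect h-preserves-I f T′⊨f s s∈I = sat-reflect f (T′⊨f (h s) (h-preserves-I s∈I))

module _ {nb ni n : ℕ} (φ : Fin n → Predicate ni) where
  open Abstraction {nb} {ni} {n} φ

  abstraction : CState nb ni → AState
  abstraction σ = record { bv = CState.bv σ
                         ; bp = λ i → eval (φ i) (CState.iv σ)
                         ; iv = λ v _ → CState.iv σ v }

  Abs-abstraction : ∀ σ → Abs σ (abstraction σ)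
  Abs-abstraction σ = (λ _ → refl) , (λ _ _ → refl) , (λ _ → refl)

  Single-refl : ∀ s → Single s s
  Single-refl s = (λ _ → refl) , (λ _ → refl)

  α-abstraction : ∀ s → α (Single s) (abstraction s)
  α-abstraction s = s , Single-refl s , Abs-abstraction s

  CS-abstraction : ∀ σ σ′ → CS σ σ′ (abstraction σ) (abstraction σ′)
  CS-abstraction σ σ′ i σ′≈σ = local (φ i) _ _ σ′≈σ

  abstraction-preserves-R : (T : TS (CState nb ni)) → ∀ {s s′} → TS.R T s s′ →
                            TS.R (abstractTS T) (abstraction s) (abstraction s′)
  abstraction-preserves-R T {s} {s′} r =
    s , s′ , r , s , s′ , (Single-refl s , Single-refl s′) ,
    CS-abstraction s s′ , Abs-abstraction s , Abs-abstraction s′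

  abstraction-preserves-I : (T : TS (CState nb ni)) → ∀ {s} → TS.I T s →
                            TS.I (abstractTS T) (abstraction s)
  abstraction-preserves-I T {s} s∈I = s , s∈I , α-abstraction s

lemma7 : {nb ni n : ℕ} (φ : Fin n → Predicate ni) (T : TS (CState nb ni)) →
    WellFormed T →
    (f : ACTL (Abstraction.AState {nb} {ni} {n} φ)) →
    Abstraction.abstractTS φ T ⊨ f →
    T ⊨ Abstraction.γ φ f
lemma7 φ T _ = ⊨-reflect (abstraction φ) (abstraction-preserves-R φ T)
                         (abstraction-preserves-I φ T)
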